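{- Let $n\ge1$, $\mathsf{AP}_L,\mathsf{AP}^O$ finite sets, $\mathcal{I}=2^{\mathsf{AP}_L\times\{0,\dots,n-1\}}$, $\mathcal{O}=2^{\mathsf{AP}^O\times\{0,\dots,n-1\}}$, and let $\langle T,\tau\rangle$ be a computation tree with $T=\mathcal{I}^*$ and $\tau:T\to\mathcal{O}$ such that $\mathrm{rep}_S(t)$ divides $\mathrm{rep}_S(\tau(t))$ for every $t\in T$. Then $\langle T,\tau\rangle$ has a unique symmetric completion, and this symmetric completion has the symmetry property. Furthermore, if $\langle T,\tau\rangle$ is regular, then so is its symmetric completion.
   Context: $x\bmod n\in\{0,\dots,n-1\}$. For a set $\mathsf{AP}$, $u\subseteq\mathsf{AP}\times\{0,\dots,n-1\}$, $k\in\mathbb{Z}$: $\mathrm{rot}(u,k)=\{(p,(j+k)\bmod n)\mid (p,j)\in u\}$, extended letterwise to finite words. For $x\subseteq \mathsf{AP}\times\{0,\dots,n-1\}$, $\mathrm{rep}(x)=|\{j\in\{0,\dots,n-1\}\mid \mathrm{rot}(x,j)=x\}|$. For words over $2^{\mathsf{AP}\times\{0,\dots,n-1\}}$: $\mathrm{rep}_S(\epsilon)=n$ and $\mathrm{rep}_S(w_0\dots w_l)=\gcd(\mathrm{rep}_S(w_0\dots w_{l-1}),\mathrm{rep}(w_l))$; a single letter $\tau(t)\in\mathcal{O}$ is treated as a word of length one. A computation tree is $\langle T,\tau\rangle$ with $T=\mathcal{I}^*$, $\tau:T\to\mathcal{O}$; it is regular if it has finitely many distinct subtrees $t\mapsto\tau(\hat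 t t)$ ($\hat t\in T$); it has the symmetry property if $\tau(\mathrm{rot}(t,i))=\mathrm{rot}(\tau(t),i)$ for all $t\in T$, $0\le i<n$. Order $\mathcal{I}$ by comparing the tuple representations $(X_0,\dots,X_{n-1})$ (where $X_j=\{x\mid (x,j)\in\iota\}$) lexicographically with respect to a fixed total order on $2^{\mathsf{AP}_L}$, and order $\mathcal{I}^*$ lexicographically. For $t\in T$ let $\eta_S(t)=\min_{0\le i<n}\mathrm{rot}(t,i)$. A symmetric completion of $\langle T,\tau\rangle$ is a tree $\langle T,\tau'\rangle$, $\tau':T\to\mathcal{O}$, such that for every $t\in T$, $\tau'(t)=\mathrm{rot}(\tau(\eta_S(t)),i)$ for some $i\in\mathbb{N}$ with $\mathrm{rot}(\eta_S(t),i)=t$. -}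

module Defs where

open import Level using (0ℓ)
open import Data.Bool using (Bool; true; false)
open import Data.Bool.Properties using () renaming (_≟_ to _≟B_)
open import Data.Nat using (ℕ; zero; suc; _+_; _∸_; NonZero)
open import Data.Nat.DivMod using (_%_; m%n<n)
open import Data.Nat.GCD using (gcd)
open import Data.Fin using (Fin; toℕ; fromℕ<)
open import Data.Vec using (Vec; tabulate; lookup) renaming ([] to []ᵥ; _∷_ to _∷ᵥ_)
open import Data.Vec.Properties using (≡-dec)
open import Data.List using (List; []; _∷_; map; foldl; foldr; _++_; upTo; length; filter)
open import Data.List.Relation.Unary.Any using (Any)
open import Data.Product using (Σ; _×_; ∃-syntax)
open import Relation.Binary using (Rel; IsStrictTotalOrder; Tri; tri<; tri≈; tri>; DecidableEquality)
open import Relation.Binary.PropositionalEquality using (_≡_)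
open import Relation.Nullary using (does)
open import Data.List using (allFin)

-- Atomic propositions: AP = Fin k (an arbitrary finite set).
-- A subset of AP is a Bool-vector (characteristic function).
Subset : ℕ → Set
Subset k = Vec Bool k

-- A subset u ⊆ AP × {0,…,n-1} in tuple representation (X_0,…,X_{n-1}),
-- X_j = {x | (x , j) ∈ u}.
Letter : ℕ → ℕ → Set
Letter k n = Vec (Subset k) n

-- rot(u,k) = {(p,(j+k) mod n) | (p,j) ∈ u}, i.e. the new j'-th component
-- is the old component at index (j' - k) mod n = (j' + (n - k mod n)) mod n.
rot : ∀ {A : Set} {n} .{{_ : NonZero n}} → Vec A n → ℕ → Vec A n
rot {n = n} u k =
  tabulate (λ i → lookup u (fromℕ< (m%n<n (toℕ i + (n ∸ (k % n))) n)))

rotW : ∀ {A : Set} {n} .{{_ : NonZero n}} → List (Vec A n) → ℕ → List (Vec A n)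
rotW w k = map (λ u → rot u k) w

rep : ∀ {k n} .{{_ : NonZero n}} → Letter k n → ℕ
rep {n = n} x = length (filter (λ j → ≡-dec (≡-dec _≟B_) (rot x j) x) (upTo n))

repS : ∀ {k n} .{{_ : NonZero n}} → List (Letter k n) → ℕ
repS {n = n} w = foldl (λ r x → gcd r (rep x)) n w

-- Computation trees  τ : I* → O  with I = Letter a n, O = Letter b n.
Tree : ℕ → ℕ → ℕ → Set
Tree a b n = List (Letter a n) → Letter b n

-- finitely many distinct subtrees t ↦ τ(t̂ t) (distinct as functions,
-- i.e. up to extensional equality)
Regular : ∀ {a b n} → Tree a b n → Set
Regular {a} {b} {n} τ =
  ∃[ fs ] ((t̂ : List (Letter a n)) →
     Any (λ (f : List (Letter a n) → Letter b n) → (t : List (Letter a n)) → τ (t̂ ++ t) ≡ f t) fs)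

Symmetric : ∀ {a b n} .{{_ : NonZero n}} → Tree a b n → Set
Symmetric {a} {b} {n} τ =
  (t : List (Letter a n)) (i : Fin n) → τ (rotW t (toℕ i)) ≡ rot (τ t) (toℕ i)

data Ord3 : Set where
  lt eq gt : Ord3

module Ordering {a : ℕ} {_<_ : Rel (Subset a) 0ℓ}
                (sto : IsStrictTotalOrder _≡_ _<_) where
  open IsStrictTotalOrder sto using (compare)

  cmpS : Subset a → Subset a → Ord3
  cmpS x y with compare x y
  ... | tri< _ _ _ = lt
  ... | tri≈ _ _ _ = eq
  ... | tri> _ _ _ = gt

  cmpL : ∀ {n} → Letter a n → Letter a n → Ord3
  cmpL []ᵥ []ᵥ = eq
  cmpL (x ∷ᵥ xs) (y ∷ᵥ ys) with cmpS x y
  ... | lt = lt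
  ... | gt = gt
  ... | eq = cmpL xs ys

  cmpW : ∀ {n} → List (Letter a n) → List (Letter a n) → Ord3
  cmpW [] [] = eq
  cmpW [] (_ ∷ _) = lt
  cmpW (_ ∷ _) [] = gt
  cmpW (x ∷ xs) (y ∷ ys) with cmpL x y
  ... | lt = lt
  ... | gt = gt
  ... | eq = cmpW xs ys

  minW : ∀ {n} → List (Letter a n) → List (Letter a n) → List (Letter a n)
  minW u v with cmpW u v
  ... | gt = v
  ... | _  = u

  ηS : ∀ {n} .{{_ : NonZero n}} → List (Letter a n) → List (Letter a n)
  ηS {n} t = foldr minW (rotW t 0) (map (rotW t) (upTo n))

  IsSymCompletion : ∀ {b n} .{{_ : NonZero n}} → Tree a b n → Tree a b n → Set
  IsSymCompletion {b} {n} τ τ' =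
    (t : List (Letter a n)) →
      ∃[ i ] (rotW (ηS t) i ≡ t × τ' t ≡ rot (τ (ηS t)) i)

module Submission where

-- Write ηS t for the least rotation of the word t.  We set
--   τ' t = rot (τ (ηS t)) i   for some i with rotW (ηS t) i ≡ t.
-- This is well defined because the rotations fixing a word w are exactly the
-- j with n ∣ j * repS w (for a letter x: the multiples of its least period,
-- of which there are rep x below n), so the hypothesis repS t ∣ repS [ τ t ]
-- says that every rotation fixing t also fixes τ t.  Well-definedness gives
-- uniqueness of the completion at once, and symmetry follows from
-- ηS (rotW t m) ≡ ηS t.  For regularity we show that ηS (t̂ ++ t) is ηS t̂
-- followed by the least rotation of the suffix among the rotations fixing
-- ηS t̂; hence every subtree of τ' is obtained from a subtree of τ and two
-- numbers bounded by n, a finite amount of data.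

open import Defs
open import Level using (0ℓ)
open import Function using (_∘_; _⇔_; mk⇔; Equivalence)
open import Data.Empty using (⊥-elim)
open import Data.Sum using (_⊎_; inj₁; inj₂)
open import Data.Product using (Σ; ∃; _×_; _,_; proj₁; proj₂)
open import Data.Bool.Properties using () renaming (_≟_ to _≟B_)
open import Data.Nat using (ℕ; zero; suc; pred; _+_; _*_; _∸_; _<_; NonZero; s≤s; s≤s⁻¹; >-nonZero⁻¹)
open import Data.Nat.Properties
open import Data.Nat.DivMod
open import Data.Nat.Divisibility
open import Data.Nat.GCD using (gcd; gcd[m,n]∣m; gcd[m,n]∣n; gcd-greatest; c*gcd[m,n]≡gcd[cm,cn])
open import Data.Nat.Solver using (module +-*-Solver)
open import Data.Fin using (Fin; toℕ; fromℕ<)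
open import Data.Fin.Properties using (fromℕ<-toℕ; toℕ-fromℕ<; fromℕ<-cong; toℕ<n)
open import Data.Vec using (Vec; tabulate; lookup) renaming ([] to []ᵥ; _∷_ to _∷ᵥ_)
open import Data.Vec.Properties using (tabulate-cong; lookup∘tabulate; tabulate∘lookup; ≡-dec)
open import Data.List using (List; []; _∷_; [_]; map; _++_; upTo; filter; length; foldl; foldr; concat; cartesianProductWith)
open import Data.List.Properties using (map-cong; map-++; upTo-∷ʳ; filter-++; length-++; ∷-injective; length-map)
import Data.List.Properties as List
open import Data.List.Membership.Propositional using (_∈_)
open import Data.List.Membership.Propositional.Properties using (∈-upTo⁺; ∈-upTo⁻; ∈-filter⁺; ∈-cartesianProductWith⁺)
open import Data.List.Relation.Unary.Any as Any using (Any; here; there)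
open import Data.List.Relation.Unary.Any.Properties using (map⁺; concat⁺)
open import Data.List.Relation.Unary.All as All using (All; []; _∷_)
open import Data.List.Relation.Unary.All.Properties using (all-filter)
open import Relation.Nullary using (¬_; yes; no)
open import Relation.Unary using (Decidable)
open import Relation.Binary using (Rel; IsStrictTotalOrder; tri<; tri≈; tri>)
open import Relation.Binary.PropositionalEquality hiding ([_])

-- Arithmetic modulo n, and the group laws of rotation.
module Rotation {n : ℕ} .{{_ : NonZero n}} where

  infix 4 _≋_
  _≋_ : ℕ → ℕ → Set
  a ≋ b = a % n ≡ b % n

  ≋-+ : ∀ {a a' b b'} → a ≋ a' → b ≋ b' → a + b ≋ a' + b'
  ≋-+ {a} {a'} {b} {b'} p q = begin
    (a + b) % n                 ≡⟨ %-distribˡ-+ a b n ⟩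
    (a % n + b % n) % n         ≡⟨ cong₂ (λ x y → (x + y) % n) p q ⟩
    (a' % n + b' % n) % n       ≡⟨ %-distribˡ-+ a' b' n ⟨
    (a' + b') % n               ∎
    where open ≡-Reasoning

  ≋-+ʳ : ∀ {a a'} b → a ≋ a' → a + b ≋ a' + b
  ≋-+ʳ b p = ≋-+ p refl

  %-≋ : ∀ a → a % n ≋ a
  %-≋ a = m%n%n≡m%n a n

  0%n≡0 : 0 % n ≡ 0
  0%n≡0 = m<n⇒m%n≡m (>-nonZero⁻¹ n)

  neg : ℕ → ℕ
  neg k = n ∸ k % n

  neg-inv : ∀ k → neg k + k ≋ 0
  neg-inv k = begin
    (neg k + k) % n         ≡⟨ ≋-+ {neg k} refl (sym (%-≋ k)) ⟩
    (neg k + k % n) % n     ≡⟨ cong (_% n) (m∸n+n≡m (m%n≤n k n)) ⟩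
    n % n                   ≡⟨ n%n≡0 n ⟩
    0                       ≡⟨ 0%n≡0 ⟨
    0 % n                   ∎
    where open ≡-Reasoning

  neg-invʳ : ∀ k → k + neg k ≋ 0
  neg-invʳ k = trans (cong (_% n) (+-comm k (neg k))) (neg-inv k)

  ≋-absorb : ∀ a c → c ≋ 0 → a + c ≋ a
  ≋-absorb a c p = trans (≋-+ {a} refl p) (cong (_% n) (+-identityʳ a))

  ≋-cancelʳ : ∀ {a b} c → a + c ≋ b + c → a ≋ b
  ≋-cancelʳ {a} {b} c p = begin
    a % n                    ≡⟨ ≋-absorb a (c + neg c) (neg-invʳ c) ⟨
    (a + (c + neg c)) % n    ≡⟨ cong (_% n) (+-assoc a c (neg c)) ⟨
    (a + c + neg c) % n      ≡⟨ ≋-+ʳ (neg c) p ⟩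
    (b + c + neg c) % n      ≡⟨ cong (_% n) (+-assoc b c (neg c)) ⟩
    (b + (c + neg c)) % n    ≡⟨ ≋-absorb b (c + neg c) (neg-invʳ c) ⟩
    b % n                    ∎
    where open ≡-Reasoning

  -- rot u k reads position m of u from position (m + neg k) mod n.
  source : ℕ → ℕ → ℕ
  source k m = (m + neg k) % n

  -- Composing index maps adds rotation amounts; we cancel i + j modulo n.
  source-comp : ∀ i j m → source i (source j m) ≡ source (i + j) m
  source-comp i j m = ≋-cancelʳ (i + j) (trans lhs (sym rhs))
    where
    open +-*-Solver
    shuffle : ∀ x y z i j → (x + y + z) + (i + j) ≡ x + (y + j) + (z + i)
    shuffle = solve 5 (λ x y z i j → (x :+ y :+ z) :+ (i :+ j) := x :+ (y :+ j) :+ (z :+ i)) refl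
    lhs : (m + neg j) % n + neg i + (i + j) ≋ m
    lhs = trans (≋-+ʳ (i + j) (≋-+ʳ (neg i) (%-≋ (m + neg j))))
            (trans (cong (_% n) (shuffle m (neg j) (neg i) i j))
              (trans (≋-absorb _ _ (neg-inv i)) (≋-absorb m _ (neg-inv j))))
    rhs : m + neg (i + j) + (i + j) ≋ m
    rhs = trans (cong (_% n) (+-assoc m _ _)) (≋-absorb m _ (neg-inv (i + j)))

  lookup-rot : ∀ {A : Set} (u : Vec A n) k (i : Fin n) →
               lookup (rot u k) i ≡ lookup u (fromℕ< (m%n<n (toℕ i + neg k) n))
  lookup-rot u k i = lookup∘tabulate _ i

  rot-source : ∀ {A : Set} (u : Vec A n) k k' → (∀ m → source k m ≡ source k' m) → rot u k ≡ rot u k'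
  rot-source u k k' h = tabulate-cong (λ i → cong (lookup u) (fromℕ<-cong _ _ (h (toℕ i)) _ _))

  rot-≋ : ∀ {A : Set} (u : Vec A n) {k k'} → k ≋ k' → rot u k ≡ rot u k'
  rot-≋ u {k} {k'} e = rot-source u k k' (λ m → cong (λ z → (m + (n ∸ z)) % n) e)

  rot-zero : ∀ {A : Set} (u : Vec A n) → rot u 0 ≡ u
  rot-zero u = trans (tabulate-cong λ i → cong (lookup u) (fromℕ<-identity i)) (tabulate∘lookup u)
    where
    source-zero : ∀ (i : Fin n) → source 0 (toℕ i) ≡ toℕ i
    source-zero i = trans (≋-absorb (toℕ i) (neg 0) (trans (cong (_% n) (sym (+-identityʳ (neg 0)))) (neg-inv 0)))
                          (m<n⇒m%n≡m (toℕ<n i))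
    fromℕ<-identity : ∀ (i : Fin n) → fromℕ< (m%n<n (toℕ i + neg 0) n) ≡ i
    fromℕ<-identity i = trans (fromℕ<-cong _ _ (source-zero i) _ (toℕ<n i)) (fromℕ<-toℕ i _)

  rot-rot : ∀ {A : Set} (u : Vec A n) i j → rot (rot u i) j ≡ rot u (i + j)
  rot-rot u i j = tabulate-cong λ m → trans (lookup-rot u i _)
    (cong (lookup u) (fromℕ<-cong _ _ (trans (cong (λ z → (z + neg i) % n) (toℕ-fromℕ< _))
                                              (source-comp i j (toℕ m))) _ _))

  rotW-≋ : ∀ {A : Set} (w : List (Vec A n)) {k k'} → k ≋ k' → rotW w k ≡ rotW w k'
  rotW-≋ w e = map-cong (λ u → rot-≋ u e) w

  rotW-zero : ∀ {A : Set} (w : List (Vec A n)) → rotW w 0 ≡ w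
  rotW-zero [] = refl
  rotW-zero (x ∷ w) = cong₂ _∷_ (rot-zero x) (rotW-zero w)

  rotW-rotW : ∀ {A : Set} (w : List (Vec A n)) i j → rotW (rotW w i) j ≡ rotW w (i + j)
  rotW-rotW [] i j = refl
  rotW-rotW (x ∷ w) i j = cong₂ _∷_ (rot-rot x i j) (rotW-rotW w i j)

  rotW-++ : ∀ {A : Set} (u v : List (Vec A n)) k → rotW (u ++ v) k ≡ rotW u k ++ rotW v k
  rotW-++ u v k = map-++ _ u v

  rotW-neg-rot : ∀ {A : Set} (w : List (Vec A n)) k → rotW (rotW w (neg k)) k ≡ w
  rotW-neg-rot w k = trans (rotW-rotW w (neg k) k) (trans (rotW-≋ w (neg-inv k)) (rotW-zero w))

  rotW-rot-neg : ∀ {A : Set} (w : List (Vec A n)) k → rotW (rotW w k) (neg k) ≡ w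
  rotW-rot-neg w k = trans (rotW-rotW w k (neg k)) (trans (rotW-≋ w (neg-invʳ k)) (rotW-zero w))

module CountMultiples {P : ℕ → Set} (P? : Decidable P) (e : ℕ)
                      (P⇔ : ∀ j → P j ⇔ suc e ∣ j) where

  d : ℕ
  d = suc e

  count : ℕ → ℕ
  count m = length (filter P? (upTo m))

  count-suc : ∀ m → count (suc m) ≡ count m + length (filter P? [ m ])
  count-suc m = begin
    length (filter P? (upTo (suc m)))              ≡⟨ cong (length ∘ filter P?) (upTo-∷ʳ m) ⟨
    length (filter P? (upTo m ++ [ m ]))           ≡⟨ cong length (filter-++ P? (upTo m) [ m ]) ⟩
    length (filter P? (upTo m) ++ filter P? [ m ]) ≡⟨ length-++ (filter P? (upTo m)) ⟩
    count m + length (filter P? [ m ])             ∎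
    where open ≡-Reasoning

  count-yes : ∀ m → P m → count (suc m) ≡ suc (count m)
  count-yes m p with P? m | count-suc m
  ... | yes _ | split = trans split (+-comm (count m) 1)
  ... | no ¬p | _  = ⊥-elim (¬p p)

  count-no : ∀ m → ¬ P m → count (suc m) ≡ count m
  count-no m ¬p with P? m | count-suc m
  ... | yes p | _  = ⊥-elim (¬p p)
  ... | no _  | split = trans split (+-identityʳ (count m))

  -- Proved together with count-block: between q * d and (q + 1) * d only
  -- q * d itself is a multiple of d.
  count-multiples : ∀ q → count (q * d) ≡ q
  count-block : ∀ q r → r < d → count (q * d + suc r) ≡ suc q
  count-multiples zero = refl
  count-multiples (suc q) = trans (cong count (+-comm d (q * d))) (count-block q e ≤-refl)
  count-block q zero _ = trans (cong count (+-comm (q * d) 1))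
    (trans (count-yes (q * d) (Equivalence.from (P⇔ _) (n∣m*n q))) (cong suc (count-multiples q)))
  count-block q (suc r) r<d = trans (cong count (+-suc (q * d) (suc r)))
    (trans (count-no _ not-multiple) (count-block q r (<-trans (n<1+n r) r<d)))
    where
    not-multiple : ¬ P (q * d + suc r)
    not-multiple p = <⇒≱ r<d (∣⇒≤ (∣m+n∣m⇒∣n (Equivalence.to (P⇔ _) p) (n∣m*n q)))

least-below : ∀ {P : ℕ → Set} → Decidable P → ∀ m →
  (∃ λ d → d < m × P d × (∀ j → j < d → ¬ P j)) ⊎ (∀ j → j < m → ¬ P j)
least-below P? zero = inj₂ (λ _ ())
least-below {P} P? (suc m) with least-below P? m
... | inj₁ (d , d<m , pd , below) = inj₁ (d , m<n⇒m<1+n d<m , pd , below)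
... | inj₂ none with P? m
...   | yes pm = inj₁ (m , ≤-refl , pm , none)
...   | no ¬pm = inj₂ λ j j<1+m → case-split j (m≤n⇒m<n∨m≡n (s≤s⁻¹ j<1+m))
  where
  case-split : ∀ j → j < m ⊎ j ≡ m → ¬ P j
  case-split j (inj₁ j<m) = none j j<m
  case-split j (inj₂ refl) = ¬pm

-- The rotations fixing a letter x are exactly the j with n ∣ j * rep x:
-- they are the multiples of the least positive period p of x, and since
-- p ∣ n there are rep x = n / p of them below n.
module LetterStabiliser {n : ℕ} .{{_ : NonZero n}} {c : ℕ} (x : Letter c n) where
  open Rotation {n}

  Fixes : ℕ → Set
  Fixes j = rot x j ≡ x

  fixes? : Decidable Fixes
  fixes? j = ≡-dec (≡-dec _≟B_) (rot x j) x

  fixes-+ : ∀ i j → Fixes i → Fixes j → Fixes (i + j)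
  fixes-+ i j fi fj = trans (sym (rot-rot x i j)) (trans (cong (λ z → rot z j) fi) fj)

  fixes-multiple : ∀ {p} q → Fixes p → Fixes (q * p)
  fixes-multiple zero fp = rot-zero x
  fixes-multiple {p} (suc q) fp = fixes-+ p (q * p) fp (fixes-multiple q fp)

  fixes-n : Fixes n
  fixes-n = trans (rot-≋ x (trans (n%n≡0 n) (sym 0%n≡0))) (rot-zero x)

  least-period : ∃ λ e → Fixes (suc e) × (∀ j → j < e → ¬ Fixes (suc j))
  least-period with least-below (fixes? ∘ suc) n
  ... | inj₁ (e , _ , fixes-e , below) = e , fixes-e , below
  ... | inj₂ none = ⊥-elim (none (pred n) (subst (pred n <_) (suc-pred n) ≤-refl)
                                         (subst Fixes (sym (suc-pred n)) fixes-n))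

  e : ℕ
  e = proj₁ least-period

  period : ℕ
  period = suc e

  -- Fixing rotations are exactly the multiples of the least period: the
  -- remainder of a fixing j modulo the period fixes x, so it must vanish.
  multiple⇒fixes : ∀ {j} → period ∣ j → Fixes j
  multiple⇒fixes (divides q refl) = fixes-multiple q (proj₁ (proj₂ least-period))

  fixes⇔ : ∀ j → Fixes j ⇔ period ∣ j
  fixes⇔ j = mk⇔ to multiple⇒fixes
    where
    remainder-fixed : Fixes j → Fixes (j % period)
    remainder-fixed fj = begin
      rot x (j % period)                          ≡⟨ cong (λ z → rot z (j % period)) (multiple⇒fixes (n∣m*n (j / period))) ⟨
      rot (rot x (j / period * period)) (j % period) ≡⟨ rot-rot x _ _ ⟩
      rot x (j / period * period + j % period)    ≡⟨ cong (rot x) (+-comm _ (j % period)) ⟩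
      rot x (j % period + j / period * period)    ≡⟨ cong (rot x) (m≡m%n+[m/n]*n j period) ⟨
      rot x j                                     ≡⟨ fj ⟩
      x                                           ∎
      where open ≡-Reasoning
    to : Fixes j → period ∣ j
    to fj with j % period in rem | remainder-fixed fj
    ... | zero  | _ = m%n≡0⇒n∣m j period rem
    ... | suc r | fr = ⊥-elim (proj₂ (proj₂ least-period) r r<e fr)
      where
      r<e : r < e
      r<e = s≤s⁻¹ (subst (_< period) rem (m%n<n j period))

  period∣n : period ∣ n
  period∣n = Equivalence.to (fixes⇔ n) fixes-n

  orbit-size : ℕ
  orbit-size = _∣_.quotient period∣n

  n≡ : n ≡ period * orbit-size
  n≡ = trans (_∣_.equality period∣n) (*-comm orbit-size period)

  rep≡orbit-size : rep x ≡ orbit-size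
  rep≡orbit-size = trans (cong count (_∣_.equality period∣n)) (count-multiples orbit-size)
    where open CountMultiples fixes? e fixes⇔

  -- The main fact: j fixes x iff period ∣ j iff period * orbit-size ∣ j * orbit-size.
  stabiliser : ∀ j → Fixes j ⇔ n ∣ j * rep x
  stabiliser j = mk⇔
    (λ fj → subst₂ _∣_ (sym n≡) (cong (j *_) (sym rep≡orbit-size))
                   (*-monoˡ-∣ orbit-size (Equivalence.to (fixes⇔ j) fj)))
    (λ n∣ → Equivalence.from (fixes⇔ j)
               (*-cancelʳ-∣ orbit-size {{quotient≢0 period∣n}}
                 (subst₂ _∣_ n≡ (cong (j *_) rep≡orbit-size) n∣)))

-- Lifting to words: rotW w j ≡ w  iff  n ∣ j * repS w.
module WordStabiliser {n : ℕ} .{{_ : NonZero n}} where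
  open Rotation {n}

  ∣-*gcd : ∀ j a b → n ∣ j * gcd a b ⇔ (n ∣ j * a × n ∣ j * b)
  ∣-*gcd j a b = mk⇔
    (λ h → ∣-trans h (*-monoʳ-∣ j (gcd[m,n]∣m a b)) , ∣-trans h (*-monoʳ-∣ j (gcd[m,n]∣n a b)))
    (λ (ha , hb) → subst (n ∣_) (sym (c*gcd[m,n]≡gcd[cm,cn] j a b)) (gcd-greatest ha hb))

  repFrom : ∀ {c} → ℕ → List (Letter c n) → ℕ
  repFrom r w = foldl (λ r x → gcd r (rep x)) r w

  -- Each step of the fold adds the constraint that the new letter is fixed.
  repFrom-stabiliser : ∀ {c} (w : List (Letter c n)) r j →
    n ∣ j * repFrom r w ⇔ (n ∣ j * r × rotW w j ≡ w)
  repFrom-stabiliser [] r j = mk⇔ (_, refl) proj₁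
  repFrom-stabiliser (x ∷ w) r j = mk⇔ to from
    where
    open LetterStabiliser x using (stabiliser)
    ih : n ∣ j * repFrom (gcd r (rep x)) w ⇔ (n ∣ j * gcd r (rep x) × rotW w j ≡ w)
    ih = repFrom-stabiliser w (gcd r (rep x)) j
    to : n ∣ j * repFrom r (x ∷ w) → n ∣ j * r × rotW (x ∷ w) j ≡ x ∷ w
    to h with Equivalence.to ih h
    ... | hg , fixes-w with Equivalence.to (∣-*gcd j r (rep x)) hg
    ...   | hr , hx = hr , cong₂ _∷_ (Equivalence.from (stabiliser j) hx) fixes-w
    from : n ∣ j * r × rotW (x ∷ w) j ≡ x ∷ w → n ∣ j * repFrom r (x ∷ w)
    from (hr , fixes) with ∷-injective fixes
    ... | fixes-x , fixes-w = Equivalence.from ih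
            (Equivalence.from (∣-*gcd j r (rep x)) (hr , Equivalence.to (stabiliser j) fixes-x) , fixes-w)

  -- In particular repS w divides n (hence is at most n).
  repFrom-∣ : ∀ {c} r (w : List (Letter c n)) → repFrom r w ∣ r
  repFrom-∣ r [] = ∣-refl
  repFrom-∣ r (x ∷ w) = ∣-trans (repFrom-∣ (gcd r (rep x)) w) (gcd[m,n]∣m r (rep x))

  -- Starting the fold at n, the divisibility constraint on r is trivial.
  word-stabiliser : ∀ {c} (w : List (Letter c n)) j → rotW w j ≡ w ⇔ n ∣ j * repS w
  word-stabiliser w j = mk⇔
    (λ fixes → Equivalence.from (repFrom-stabiliser w n j) (n∣m*n j , fixes))
    (λ h → proj₂ (Equivalence.to (repFrom-stabiliser w n j) h))

flipO : Ord3 → Ord3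
flipO lt = gt
flipO eq = eq
flipO gt = lt

record TotalComparison {A : Set} (c : A → A → Ord3) : Set where
  field
    eq⇒≡     : ∀ {x y} → c x y ≡ eq → x ≡ y
    c-refl   : ∀ x → c x x ≡ eq
    c-flip   : ∀ x y → c y x ≡ flipO (c x y)
    lt-trans : ∀ {x y z} → c x y ≡ lt → c y z ≡ lt → c x z ≡ lt

lex : Ord3 → Ord3 → Ord3
lex lt _ = lt
lex eq o = o
lex gt _ = gt

-- How lex combines a total comparison on heads with the results on tails;
-- this is the induction step for both letters (vectors) and words (lists).
module Lex {A : Set} {c : A → A → Ord3} (C : TotalComparison c) where
  open TotalComparison C

  lex-eq : ∀ {x y o} → lex (c x y) o ≡ eq → x ≡ y × o ≡ eq
  lex-eq {x} {y} h with c x y in cxy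
  lex-eq () | lt
  ... | eq = eq⇒≡ cxy , h
  lex-eq () | gt

  lex-refl : ∀ x {o} → o ≡ eq → lex (c x x) o ≡ eq
  lex-refl x o≡eq rewrite c-refl x = o≡eq

  lex-flip : ∀ x y {o o'} → o' ≡ flipO o → lex (c y x) o' ≡ flipO (lex (c x y) o)
  lex-flip x y h with c x y | c y x | c-flip x y
  ... | lt | .gt | refl = refl
  ... | eq | .eq | refl = h
  ... | gt | .lt | refl = refl

  lex-trans : ∀ x y z {o₁ o₂ o₃} → (o₁ ≡ lt → o₂ ≡ lt → o₃ ≡ lt) →
              lex (c x y) o₁ ≡ lt → lex (c y z) o₂ ≡ lt → lex (c x z) o₃ ≡ lt
  lex-trans x y z tails h₁ h₂ with c x y in cxy | c y z in cyz
  ... | lt | lt rewrite lt-trans cxy cyz = refl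
  ... | lt | eq with refl ← eq⇒≡ cyz rewrite cxy = refl
  ... | eq | lt with refl ← eq⇒≡ cxy rewrite cyz = refl
  ... | eq | eq with refl ← eq⇒≡ cxy | refl ← eq⇒≡ cyz rewrite c-refl x = tails h₁ h₂
  lex-trans x y z tails () h₂ | gt | _
  lex-trans x y z tails h₁ () | lt | gt
  lex-trans x y z tails h₁ () | eq | gt

module Comparisons {a : ℕ} {_≺_ : Rel (Subset a) 0ℓ} (sto : IsStrictTotalOrder _≡_ _≺_) where
  open Ordering sto
  open IsStrictTotalOrder sto using (compare; irrefl; asym) renaming (trans to ≺-trans)

  cmpS-total : TotalComparison cmpS
  cmpS-total = record { eq⇒≡ = eq⇒≡ ; c-refl = c-refl ; c-flip = c-flip ; lt-trans = lt-trans }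
    where
    eq⇒≡ : ∀ {x y} → cmpS x y ≡ eq → x ≡ y
    eq⇒≡ {x} {y} h with compare x y
    eq⇒≡ () | tri< _ _ _
    ... | tri≈ _ x≡y _ = x≡y
    eq⇒≡ () | tri> _ _ _
    c-refl : ∀ x → cmpS x x ≡ eq
    c-refl x with compare x x
    ... | tri< x<x _ _ = ⊥-elim (irrefl refl x<x)
    ... | tri≈ _ _ _ = refl
    ... | tri> _ _ x<x = ⊥-elim (irrefl refl x<x)
    c-flip : ∀ x y → cmpS y x ≡ flipO (cmpS x y)
    c-flip x y with compare x y | compare y x
    ... | tri< p _ _  | tri< q _ _  = ⊥-elim (asym p q)
    ... | tri< _ ¬b _ | tri≈ _ b _  = ⊥-elim (¬b (sym b))
    ... | tri< _ _ _  | tri> _ _ _  = refl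
    ... | tri≈ _ b _  | tri< _ ¬b _ = ⊥-elim (¬b (sym b))
    ... | tri≈ _ _ _  | tri≈ _ _ _  = refl
    ... | tri≈ _ b _  | tri> _ ¬b _ = ⊥-elim (¬b (sym b))
    ... | tri> _ _ _  | tri< _ _ _  = refl
    ... | tri> _ ¬b _ | tri≈ _ b _  = ⊥-elim (¬b (sym b))
    ... | tri> _ _ p  | tri> _ _ q  = ⊥-elim (asym p q)
    lt-trans : ∀ {x y z} → cmpS x y ≡ lt → cmpS y z ≡ lt → cmpS x z ≡ lt
    lt-trans {x} {y} {z} h₁ h₂ with compare x y | compare y z | compare x z
    ... | tri< p _ _ | tri< q _ _ | tri< _ _ _  = refl
    ... | tri< p _ _ | tri< q _ _ | tri≈ ¬r _ _ = ⊥-elim (¬r (≺-trans p q))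
    ... | tri< p _ _ | tri< q _ _ | tri> ¬r _ _ = ⊥-elim (¬r (≺-trans p q))
    lt-trans () _ | tri≈ _ _ _ | _ | _
    lt-trans () _ | tri> _ _ _ | _ | _
    lt-trans _ () | tri< _ _ _ | tri≈ _ _ _ | _
    lt-trans _ () | tri< _ _ _ | tri> _ _ _ | _

  cmpL-∷ : ∀ {m} x y (xs ys : Letter a m) → cmpL (x ∷ᵥ xs) (y ∷ᵥ ys) ≡ lex (cmpS x y) (cmpL xs ys)
  cmpL-∷ x y xs ys with cmpS x y
  ... | lt = refl
  ... | eq = refl
  ... | gt = refl

  cmpL-total : ∀ m → TotalComparison (cmpL {m})
  cmpL-total zero = record
    { eq⇒≡ = λ { {[]ᵥ} {[]ᵥ} _ → refl } ; c-refl = λ { []ᵥ → refl }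
    ; c-flip = λ { []ᵥ []ᵥ → refl } ; lt-trans = λ { {[]ᵥ} {[]ᵥ} {[]ᵥ} () _ } }
  cmpL-total (suc m) = record
    { eq⇒≡ = eq⇒≡ ; c-refl = c-refl ; c-flip = c-flip ; lt-trans = λ {x} {y} {z} → lt-trans {x} {y} {z} }
    where
    open Lex cmpS-total
    module IH = TotalComparison (cmpL-total m)
    eq⇒≡ : ∀ {x y : Letter a (suc m)} → cmpL x y ≡ eq → x ≡ y
    eq⇒≡ {x ∷ᵥ xs} {y ∷ᵥ ys} h with lex-eq {x} {y} (trans (sym (cmpL-∷ x y xs ys)) h)
    ... | refl , tails = cong (x ∷ᵥ_) (IH.eq⇒≡ tails)
    c-refl : ∀ (x : Letter a (suc m)) → cmpL x x ≡ eq
    c-refl (x ∷ᵥ xs) = trans (cmpL-∷ x x xs xs) (lex-refl x (IH.c-refl xs))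
    c-flip : ∀ (x y : Letter a (suc m)) → cmpL y x ≡ flipO (cmpL x y)
    c-flip (x ∷ᵥ xs) (y ∷ᵥ ys) = trans (cmpL-∷ y x ys xs)
      (trans (lex-flip x y (IH.c-flip xs ys)) (cong flipO (sym (cmpL-∷ x y xs ys))))
    lt-trans : ∀ {x y z : Letter a (suc m)} → cmpL x y ≡ lt → cmpL y z ≡ lt → cmpL x z ≡ lt
    lt-trans {x ∷ᵥ xs} {y ∷ᵥ ys} {z ∷ᵥ zs} h₁ h₂ = trans (cmpL-∷ x z xs zs)
      (lex-trans x y z (IH.lt-trans {xs} {ys} {zs})
        (trans (sym (cmpL-∷ x y xs ys)) h₁) (trans (sym (cmpL-∷ y z ys zs)) h₂))

  cmpW-∷ : ∀ {m} (x y : Letter a m) xs ys → cmpW (x ∷ xs) (y ∷ ys) ≡ lex (cmpL x y) (cmpW xs ys)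
  cmpW-∷ x y xs ys with cmpL x y
  ... | lt = refl
  ... | eq = refl
  ... | gt = refl

  cmpW-total : ∀ m → TotalComparison (cmpW {m})
  cmpW-total m = record
    { eq⇒≡ = eq⇒≡ ; c-refl = c-refl ; c-flip = c-flip ; lt-trans = λ {x} {y} {z} → lt-trans {x} {y} {z} }
    where
    open Lex (cmpL-total m)
    eq⇒≡ : ∀ {x y : List (Letter a m)} → cmpW x y ≡ eq → x ≡ y
    eq⇒≡ {[]} {[]} h = refl
    eq⇒≡ {[]} {_ ∷ _} ()
    eq⇒≡ {_ ∷ _} {[]} ()
    eq⇒≡ {x ∷ xs} {y ∷ ys} h with lex-eq {x} {y} (trans (sym (cmpW-∷ x y xs ys)) h)
    ... | refl , tails = cong (x ∷_) (eq⇒≡ tails)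
    c-refl : ∀ (x : List (Letter a m)) → cmpW x x ≡ eq
    c-refl [] = refl
    c-refl (x ∷ xs) = trans (cmpW-∷ x x xs xs) (lex-refl x (c-refl xs))
    c-flip : ∀ (x y : List (Letter a m)) → cmpW y x ≡ flipO (cmpW x y)
    c-flip [] [] = refl
    c-flip [] (_ ∷ _) = refl
    c-flip (_ ∷ _) [] = refl
    c-flip (x ∷ xs) (y ∷ ys) = trans (cmpW-∷ y x ys xs)
      (trans (lex-flip x y (c-flip xs ys)) (cong flipO (sym (cmpW-∷ x y xs ys))))
    lt-trans : ∀ {x y z : List (Letter a m)} → cmpW x y ≡ lt → cmpW y z ≡ lt → cmpW x z ≡ lt
    lt-trans {[]} {[]} () _
    lt-trans {[]} {_ ∷ _} {[]} _ ()
    lt-trans {[]} {_ ∷ _} {_ ∷ _} _ _ = refl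
    lt-trans {_ ∷ _} {[]} () _
    lt-trans {_ ∷ _} {_ ∷ _} {[]} _ ()
    lt-trans {x ∷ xs} {y ∷ ys} {z ∷ zs} h₁ h₂ = trans (cmpW-∷ x z xs zs)
      (lex-trans x y z (lt-trans {xs} {ys} {zs})
        (trans (sym (cmpW-∷ x y xs ys)) h₁) (trans (sym (cmpW-∷ y z ys zs)) h₂))

module WordOrder {a : ℕ} {_≺_ : Rel (Subset a) 0ℓ} (sto : IsStrictTotalOrder _≡_ _≺_) (m : ℕ) where
  open Ordering sto
  open Comparisons sto
  open TotalComparison (cmpW-total m)

  Word : Set
  Word = List (Letter a m)

  _≤W_ : Word → Word → Set
  u ≤W v = cmpW u v ≡ lt ⊎ u ≡ v

  ≤W-trans : ∀ {u v w} → u ≤W v → v ≤W w → u ≤W w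
  ≤W-trans {u} {v} {w} (inj₁ p) (inj₁ q) = inj₁ (lt-trans {u} {v} {w} p q)
  ≤W-trans (inj₁ p) (inj₂ refl) = inj₁ p
  ≤W-trans (inj₂ refl) q = q

  ≤W-antisym : ∀ {u v} → u ≤W v → v ≤W u → u ≡ v
  ≤W-antisym (inj₂ u≡v) _ = u≡v
  ≤W-antisym (inj₁ _) (inj₂ v≡u) = sym v≡u
  ≤W-antisym {u} {v} (inj₁ p) (inj₁ q) with trans (sym q) (trans (c-flip u v) (cong flipO p))
  ... | ()

  ≤W-≢⇒lt : ∀ {u v} → u ≤W v → u ≢ v → cmpW u v ≡ lt
  ≤W-≢⇒lt (inj₁ p) _ = p
  ≤W-≢⇒lt (inj₂ u≡v) u≢v = ⊥-elim (u≢v u≡v)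

  minW-cases : ∀ u v → (minW u v ≡ u × u ≤W v) ⊎ (minW u v ≡ v × v ≤W u)
  minW-cases u v with cmpW u v in cuv
  ... | lt = inj₁ (refl , inj₁ refl)
  ... | eq = inj₁ (refl , inj₂ (eq⇒≡ cuv))
  ... | gt = inj₂ (refl , inj₁ (trans (c-flip u v) (cong flipO cuv)))

  minW-≤ˡ : ∀ u v → minW u v ≤W u
  minW-≤ˡ u v with minW-cases u v
  ... | inj₁ (min≡u , _) = inj₂ min≡u
  ... | inj₂ (min≡v , v≤u) = subst (_≤W u) (sym min≡v) v≤u

  minW-≤ʳ : ∀ u v → minW u v ≤W v
  minW-≤ʳ u v with minW-cases u v
  ... | inj₁ (min≡u , u≤v) = subst (_≤W v) (sym min≡u) u≤v
  ... | inj₂ (min≡v , _) = inj₂ min≡v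

  cmpW-common-prefix : ∀ (s u v : Word) → cmpW (s ++ u) (s ++ v) ≡ cmpW u v
  cmpW-common-prefix [] u v = refl
  cmpW-common-prefix (x ∷ s) u v =
    trans (cmpW-∷ x x (s ++ u) (s ++ v))
      (trans (cong (λ o → lex o (cmpW (s ++ u) (s ++ v))) (TotalComparison.c-refl (cmpL-total m) x))
        (cmpW-common-prefix s u v))

  ≤W-common-prefix : ∀ s {u v} → u ≤W v → (s ++ u) ≤W (s ++ v)
  ≤W-common-prefix s {u} {v} (inj₁ p) = inj₁ (trans (cmpW-common-prefix s u v) p)
  ≤W-common-prefix s (inj₂ refl) = inj₂ refl

  cmpW-prefix-lt : ∀ (u u' v v' : Word) → length u ≡ length u' → cmpW u u' ≡ lt →
                   cmpW (u ++ v) (u' ++ v') ≡ lt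
  cmpW-prefix-lt [] [] v v' _ ()
  cmpW-prefix-lt (x ∷ u) (y ∷ u') v v' same-length h =
    trans (cmpW-∷ x y (u ++ v) (u' ++ v')) (heads (trans (sym (cmpW-∷ x y u u')) h))
    where
    heads : lex (cmpL x y) (cmpW u u') ≡ lt → lex (cmpL x y) (cmpW (u ++ v) (u' ++ v')) ≡ lt
    heads h' with cmpL x y
    ... | lt = refl
    ... | eq = cmpW-prefix-lt u u' v v' (suc-injective same-length) h'
    heads () | gt

-- We treat the
-- more general minimum of the rotations of t by the amounts in a list ks,
-- since the regularity proof also minimises over a subset of rotations.
module Canonical {a : ℕ} {_≺_ : Rel (Subset a) 0ℓ} (sto : IsStrictTotalOrder _≡_ _≺_)
                 {n : ℕ} .{{_ : NonZero n}} where
  open Rotation {n}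
  open Ordering sto
  open WordOrder sto n

  minRot : Word → List ℕ → Word
  minRot t ks = foldr minW (rotW t 0) (map (rotW t) ks)

  minRot-attained : ∀ (Q : ℕ → Set) t ks → Q 0 → All Q ks → ∃ λ k → Q k × minRot t ks ≡ rotW t k
  minRot-attained Q t [] q₀ [] = 0 , q₀ , refl
  minRot-attained Q t (k ∷ ks) q₀ (qk ∷ qs) with minW-cases (rotW t k) (minRot t ks)
  ... | inj₁ (min≡k , _) = k , qk , min≡k
  ... | inj₂ (min≡rest , _) with minRot-attained Q t ks q₀ qs
  ...   | k' , qk' , rest≡ = k' , qk' , trans min≡rest rest≡

  minRot-least : ∀ t {ks k} → k ∈ ks → minRot t ks ≤W rotW t k
  minRot-least t {k ∷ ks} (here refl) = minW-≤ˡ (rotW t k) (minRot t ks)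
  minRot-least t {k' ∷ ks} (there k∈ks) = ≤W-trans (minW-≤ʳ (rotW t k') (minRot t ks)) (minRot-least t k∈ks)

  ηS-in-orbit : ∀ t → ∃ λ k → k < n × ηS t ≡ rotW t k
  ηS-in-orbit t = minRot-attained (_< n) t (upTo n) (>-nonZero⁻¹ n) (All.tabulate ∈-upTo⁻)

  ηS-least : ∀ t k → ηS t ≤W rotW t k
  ηS-least t k = subst (ηS t ≤W_) (rotW-≋ t (%-≋ k)) (minRot-least t (∈-upTo⁺ (m%n<n k n)))

  ηS-unique : ∀ t w → (∃ λ k → w ≡ rotW t k) → (∀ k → w ≤W rotW t k) → ηS t ≡ w
  ηS-unique t w (k , w≡) w-least with ηS-in-orbit t
  ... | k' , _ , ηS≡ = ≤W-antisym (subst (ηS t ≤W_) (sym w≡) (ηS-least t k))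
                                  (subst (w ≤W_) (sym ηS≡) (w-least k'))

  ηS-rotW : ∀ t m → ηS (rotW t m) ≡ ηS t
  ηS-rotW t m with ηS-in-orbit t
  ... | k , _ , ηS≡ = ηS-unique (rotW t m) (ηS t) in-orbit below
    where
    in-orbit : ∃ λ k' → ηS t ≡ rotW (rotW t m) k'
    in-orbit = neg m + k , trans ηS≡ (trans (cong (λ z → rotW z k) (sym (rotW-rot-neg t m)))
                                             (rotW-rotW (rotW t m) (neg m) k))
    below : ∀ k' → ηS t ≤W rotW (rotW t m) k'
    below k' = subst (ηS t ≤W_) (sym (rotW-rotW t m k')) (ηS-least t (m + k'))

  ηS-return : ∀ t → ∃ λ i → rotW (ηS t) i ≡ t
  ηS-return t with ηS-in-orbit t
  ... | k , _ , ηS≡ = neg k , trans (cong (λ z → rotW z (neg k)) ηS≡) (rotW-rot-neg t k)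

-- The symmetric completion of τ.  The hypothesis repS t ∣ repS [ τ t ] makes
-- τ compatible with symmetries: every rotation fixing t fixes τ t.
module Completion {a b : ℕ} {_≺_ : Rel (Subset a) 0ℓ} (sto : IsStrictTotalOrder _≡_ _≺_)
                  {n : ℕ} .{{_ : NonZero n}} (τ : Tree a b n)
                  (compatible : (t : List (Letter a n)) → repS t ∣ repS [ τ t ]) where
  open Rotation {n}
  open WordStabiliser {n}
  open Ordering sto
  open Canonical sto {n}

  -- A rotation fixing w fixes τ w: n ∣ k * repS w and repS w ∣ rep (τ w).
  output-fixed : ∀ w k → rotW w k ≡ w → rot (τ w) k ≡ τ w
  output-fixed w k fixes = Equivalence.from (LetterStabiliser.stabiliser (τ w) k)
    (∣-trans (Equivalence.to (word-stabiliser w k) fixes)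
             (*-monoʳ-∣ k (∣-trans (compatible w) (gcd[m,n]∣n n (rep (τ w))))))

  output-congruent : ∀ w {i i'} → rotW w i ≡ rotW w i' → rot (τ w) i ≡ rot (τ w) i'
  output-congruent w {i} {i'} same = begin
    rot (τ w) i                   ≡⟨ cong (λ z → rot z i) (output-fixed w k fixes) ⟨
    rot (rot (τ w) k) i           ≡⟨ rot-rot (τ w) k i ⟩
    rot (τ w) (k + i)             ≡⟨ rot-≋ (τ w) k+i≋i' ⟩
    rot (τ w) i'                  ∎
    where
    open ≡-Reasoning
    k : ℕ
    k = i' + neg i
    fixes : rotW w k ≡ w
    fixes = begin
      rotW w (i' + neg i)       ≡⟨ rotW-rotW w i' (neg i) ⟨
      rotW (rotW w i') (neg i)  ≡⟨ cong (λ z → rotW z (neg i)) same ⟨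
      rotW (rotW w i) (neg i)   ≡⟨ rotW-rot-neg w i ⟩
      w                         ∎
    k+i≋i' : k + i ≋ i'
    k+i≋i' = trans (cong (_% n) (+-assoc i' (neg i) i)) (≋-absorb i' (neg i + i) (neg-inv i))

  τ' : Tree a b n
  τ' t = rot (τ (ηS t)) (proj₁ (ηS-return t))

  τ'-via : ∀ t {s} i → ηS t ≡ s → rotW s i ≡ t → τ' t ≡ rot (τ s) i
  τ'-via t i refl s↦t = output-congruent (ηS t) (trans (proj₂ (ηS-return t)) (sym s↦t))

  -- τ' is a symmetric completion, every completion agrees with it, and it
  -- commutes with rotations since ηS is constant on rotation orbits.
  is-completion : IsSymCompletion τ τ'
  is-completion t = proj₁ (ηS-return t) , proj₂ (ηS-return t) , refl

  completion-unique : (τ'' : Tree a b n) → IsSymCompletion τ τ'' → (t : List (Letter a n)) → τ'' t ≡ τ' t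
  completion-unique τ'' c t with c t
  ... | i , s↦t , τ''≡ = trans τ''≡ (sym (τ'-via t i refl s↦t))

  symmetric : Symmetric τ'
  symmetric t i = trans (τ'-via (rotW t m) (i₀ + m) (ηS-rotW t m) s↦rotW)
                        (sym (rot-rot (τ (ηS t)) i₀ m))
    where
    m i₀ : ℕ
    m = toℕ i
    i₀ = proj₁ (ηS-return t)
    s↦rotW : rotW (ηS t) (i₀ + m) ≡ rotW t m
    s↦rotW = trans (sym (rotW-rotW (ηS t) i₀ m)) (cong (λ z → rotW z m) (proj₂ (ηS-return t)))

  -- Regularity.  The subtree of τ' at t̂ is determined by the subtree of τ at
  -- ηS t̂, by repS (ηS t̂) ≤ n and by a rotation j < n carrying ηS t̂ to t̂.
  open WordOrder sto n using (Word; _≤W_; ≤W-≢⇒lt; ≤W-common-prefix; cmpW-prefix-lt)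

  fixing? : ∀ r → Decidable (λ k → n ∣ k * r)
  fixing? r k = n ∣? k * r

  fixing : ℕ → List ℕ
  fixing r = filter (fixing? r) (upTo n)

  least-fixing-rotation : ∀ r u → ∃ λ k → n ∣ k * r × minRot u (fixing r) ≡ rotW u k
  least-fixing-rotation r u =
    minRot-attained (λ k → n ∣ k * r) u (fixing r) (n ∣0) (all-filter (fixing? r) (upTo n))

  shift : ℕ → Word → ℕ
  shift r u = proj₁ (least-fixing-rotation r u)

  fixing-least : ∀ (s u : Word) {k} → rotW s k ≡ s → minRot u (fixing (repS s)) ≤W rotW u k
  fixing-least s u {k} fixes = subst (minRot u (fixing (repS s)) ≤W_) (rotW-≋ u (%-≋ k))
    (minRot-least u (∈-filter⁺ (fixing? (repS s)) (∈-upTo⁺ (m%n<n k n))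
      (Equivalence.to (word-stabiliser s (k % n)) (trans (rotW-≋ s (%-≋ k)) fixes))))

  -- Extending t̂ = rotW (ηS t̂) j by t: the canonical form of t̂ ++ t is ηS t̂
  -- followed by the least rotation, among those fixing ηS t̂, of the suffix
  -- t aligned with ηS t̂.
  module Extension (t̂ t : Word) (j : ℕ) (s↦t̂ : rotW (ηS t̂) j ≡ t̂) where
    s t' m : Word
    k₀ : ℕ
    s = ηS t̂
    t' = rotW t (neg j)
    k₀ = shift (repS s) t'
    m = rotW t' k₀

    k₀-fixes : rotW s k₀ ≡ s
    k₀-fixes = Equivalence.from (word-stabiliser s k₀) (proj₁ (proj₂ (least-fixing-rotation (repS s) t')))

    aligned : rotW (s ++ t') j ≡ t̂ ++ t
    aligned = trans (rotW-++ s t' j) (cong₂ _++_ s↦t̂ (rotW-neg-rot t j))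

    -- s ++ m is a rotation of t̂ ++ t ...
    in-orbit : ∃ λ k → s ++ m ≡ rotW (t̂ ++ t) k
    in-orbit = neg j + k₀ , sym (begin
      rotW (t̂ ++ t) (neg j + k₀)                ≡⟨ rotW-rotW (t̂ ++ t) (neg j) k₀ ⟨
      rotW (rotW (t̂ ++ t) (neg j)) k₀           ≡⟨ cong (λ z → rotW (rotW z (neg j)) k₀) aligned ⟨
      rotW (rotW (rotW (s ++ t') j) (neg j)) k₀ ≡⟨ cong (λ z → rotW z k₀) (rotW-rot-neg (s ++ t') j) ⟩
      rotW (s ++ t') k₀                         ≡⟨ rotW-++ s t' k₀ ⟩
      rotW s k₀ ++ m                            ≡⟨ cong (_++ m) k₀-fixes ⟩
      s ++ m                                    ∎)
      where open ≡-Reasoning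

    -- ... below all others: if rotation by k moves the prefix, the prefix is
    -- already larger than s; otherwise j + k fixes s and m is minimal.
    least : ∀ k → (s ++ m) ≤W rotW (t̂ ++ t) k
    least k rewrite rotW-++ t̂ t k with List.≡-dec (≡-dec (≡-dec _≟B_)) (rotW t̂ k) s
    ... | yes prefix-fixed rewrite prefix-fixed =
      ≤W-common-prefix s (subst₂ _≤W_ (proj₂ (proj₂ (least-fixing-rotation (repS s) t'))) suffix
                                   (fixing-least s t' j+k-fixes))
      where
      suffix : rotW t' (j + k) ≡ rotW t k
      suffix = trans (sym (rotW-rotW t' j k)) (cong (λ z → rotW z k) (rotW-neg-rot t j))
      j+k-fixes : rotW s (j + k) ≡ s
      j+k-fixes = trans (sym (rotW-rotW s j k)) (trans (cong (λ z → rotW z k) s↦t̂) prefix-fixed)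
    ... | no prefix-moved = inj₁ (cmpW-prefix-lt s (rotW t̂ k) m (rotW t k) same-length
                                    (≤W-≢⇒lt (ηS-least t̂ k) (prefix-moved ∘ sym)))
      where
      same-length : length s ≡ length (rotW t̂ k)
      same-length = trans (sym (length-map _ s))
                      (trans (cong length (rotW-≋ s (%-≋ (j + k))))
                        (trans (cong length (sym (rotW-rotW s j k)))
                          (cong (λ z → length (rotW z k)) s↦t̂)))

    canonical : ηS (t̂ ++ t) ≡ s ++ m
    canonical = ηS-unique (t̂ ++ t) (s ++ m) in-orbit least

    path : rotW (s ++ m) (neg k₀ + j) ≡ t̂ ++ t
    path = begin
      rotW (s ++ m) (neg k₀ + j)                    ≡⟨ rotW-rotW (s ++ m) (neg k₀) j ⟨
      rotW (rotW (s ++ m) (neg k₀)) j               ≡⟨ cong (λ z → rotW z j) (rotW-++ s m (neg k₀)) ⟩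
      rotW (rotW s (neg k₀) ++ rotW m (neg k₀)) j   ≡⟨ cong (λ z → rotW (rotW z (neg k₀) ++ rotW m (neg k₀)) j) k₀-fixes ⟨
      rotW (rotW (rotW s k₀) (neg k₀) ++ rotW m (neg k₀)) j
                                                    ≡⟨ cong₂ (λ u v → rotW (u ++ v) j) (rotW-rot-neg s k₀) (rotW-rot-neg t' k₀) ⟩
      rotW (s ++ t') j                              ≡⟨ aligned ⟩
      t̂ ++ t                                        ∎
      where open ≡-Reasoning

  -- Candidate subtrees of τ' built from a subtree g of τ.
  shifted : (Word → Letter b n) → ℕ → ℕ → Word → Letter b n
  shifted g r j t = rot (g (rotW t' (shift r t'))) (neg (shift r t') + j)
    where
    t' : Word
    t' = rotW t (neg j)

  subtree : ∀ t̂ g → (∀ u → τ (ηS t̂ ++ u) ≡ g u) → ∀ j → rotW (ηS t̂) j ≡ t̂ →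
            ∀ t → τ' (t̂ ++ t) ≡ shifted g (repS (ηS t̂)) j t
  subtree t̂ g g-subtree j s↦t̂ t =
    trans (τ'-via (t̂ ++ t) (neg k₀ + j) canonical path) (cong (λ z → rot z (neg k₀ + j)) (g-subtree m))
    where open Extension t̂ t j s↦t̂

  candidates : (Word → Letter b n) → List (Word → Letter b n)
  candidates g = cartesianProductWith (shifted g) (upTo (suc n)) (upTo n)

  subtree-candidate : ∀ t̂ g → (∀ u → τ (ηS t̂ ++ u) ≡ g u) →
                      Any (λ f → ∀ t → τ' (t̂ ++ t) ≡ f t) (candidates g)
  subtree-candidate t̂ g g-subtree =
    Any.map (λ { refl → subtree t̂ g g-subtree j s↦t̂ })
            (∈-cartesianProductWith⁺ (shifted g) r∈ (∈-upTo⁺ (m%n<n i n)))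
    where
    i j : ℕ
    i = proj₁ (ηS-return t̂)
    j = i % n
    s↦t̂ : rotW (ηS t̂) j ≡ t̂
    s↦t̂ = trans (rotW-≋ (ηS t̂) (%-≋ i)) (proj₂ (ηS-return t̂))
    r∈ : repS (ηS t̂) ∈ upTo (suc n)
    r∈ = ∈-upTo⁺ (s≤s (∣⇒≤ (repFrom-∣ n (ηS t̂))))

  regular : Regular τ → Regular τ'
  regular (fs , has-subtree) = concat (map candidates fs) , λ t̂ →
    concat⁺ (map⁺ (Any.map (subtree-candidate t̂ _) (has-subtree (ηS t̂))))

lemma8 : (a b n : ℕ) .{{_ : NonZero n}}
    → (_<_ : Rel (Subset a) 0ℓ) (sto : IsStrictTotalOrder _≡_ _<_)
    → (τ : Tree a b n)
    → ((t : List (Letter a n)) → repS t ∣ repS [ τ t ])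
    → Σ (Tree a b n) (λ τ' →
        Ordering.IsSymCompletion sto τ τ'
        × ((τ'' : Tree a b n) → Ordering.IsSymCompletion sto τ τ''
             → (t : List (Letter a n)) → τ'' t ≡ τ' t)
        × Symmetric τ'
        × (Regular τ → Regular τ'))
lemma8 a b n _<_ sto τ compatible = τ' , is-completion , completion-unique , symmetric , regular
  where open Completion sto τ compatible
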